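{- Let $q$ be a power of a prime number, $A=\mathbb{F}_q$, $u\in U(A)$ with $u\neq\pm1_A$, and $n=2m\ge4$. Then \[|R_{2m}^{u}(A)|=\frac{(q^{m+1}-1)(q^{m}-1)}{q^{2}-1},\] where $R_{2m}^{u}(A)=\{(a_1,\dots,a_{2m})\in A^{2m} : K_{2m}(a_1,\dots,a_{2m})=u\}$.
   Context: $U(A)$ is the unit group of $A$. The continuants are defined by $K_{ -1}:=0_A$, $K_0:=1_A$, and for $i\ge1$, $K_i(X_1,\dots,X_i)$ is the determinant of the $i\times i$ tridiagonal matrix with diagonal $X_1,\dots,X_i$ and all entries on the sub- and super-diagonal equal to $1_A$. -}

module Defs where

open import Level using (Level; _⊔_) renaming (suc to lsuc)
open import Data.Nat using (ℕ; zero; suc; _^_)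
open import Data.Nat.Primality using (Prime)
open import Data.Fin using (Fin; zero; suc; toℕ; punchIn)
open import Data.Vec using (Vec; []; _∷_; lookup; map)
open import Data.List using (List; []; _∷_; concatMap; length; filter)
open import Data.Product using (Σ; ∃; _×_; _,_)
open import Relation.Nullary using (¬_; Dec; yes; no)
open import Relation.Binary using (Decidable)
open import Relation.Binary.PropositionalEquality using (_≡_)
open import Algebra.Bundles using (CommutativeRing)
open import Function using (_∘_)

IsPrimePower : ℕ → Set
IsPrimePower q = Σ ℕ λ p → Σ ℕ λ k → Prime p × q ≡ p ^ suc k

record FiniteField (c ℓ : Level) : Set (lsuc (c ⊔ ℓ)) where
  field
    cring : CommutativeRing c ℓ
  open CommutativeRing cring public
    using (Carrier; _≈_; _+_; _*_; -_; 0#; 1#)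
  field
    _≟_      : Decidable _≈_
    0≉1      : ¬ (0# ≈ 1#)
    inverse  : ∀ x → ¬ (x ≈ 0#) → ∃ λ y → x * y ≈ 1#
    size     : ℕ
    enum     : Fin size → Carrier
    enum-inj : ∀ i j → enum i ≈ enum j → i ≡ j
    enum-sur : ∀ x → ∃ λ i → enum i ≈ x

module _ {c ℓ} (R : CommutativeRing c ℓ) where
  open CommutativeRing R using (Carrier; _≈_; _+_; _*_; -_; 0#; 1#)

  IsUnit : Carrier → Set (c ⊔ ℓ)
  IsUnit u = ∃ λ v → u * v ≈ 1#

  sumFin : ∀ {n} → (Fin n → Carrier) → Carrier
  sumFin {zero}  f = 0#
  sumFin {suc n} f = f zero + sumFin (f ∘ suc)

  signed : ℕ → Carrier → Carrier
  signed zero x = x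
  signed (suc k) x = - (signed k x)

  det : ∀ n → (Fin n → Fin n → Carrier) → Carrier
  det zero    M = 1#
  det (suc n) M =
    sumFin (λ j → signed (toℕ j) (M zero j * det n (λ i k → M (suc i) (punchIn j k))))

  tridiag : ∀ {n} → Vec Carrier n → Fin n → Fin n → Carrier
  tridiag X i j with toℕ i Data.Nat.≟ toℕ j | suc (toℕ i) Data.Nat.≟ toℕ j | toℕ i Data.Nat.≟ suc (toℕ j)
  ... | yes _ | _     | _     = lookup X i
  ... | no _  | yes _ | _     = 1#
  ... | no _  | no _  | yes _ = 1#
  ... | no _  | no _  | no _  = 0#

  K : ∀ {n} → Vec Carrier n → Carrier
  K {n} X = det n (tridiag X)

allVecs : ∀ q n → List (Vec (Fin q) n)
allVecs q zero = [] ∷ []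
allVecs q (suc n) = concatMap (λ v → Data.List.map (_∷ v) (Data.List.allFin q)) (allVecs q n)

countR : ∀ {c ℓ} (F : FiniteField c ℓ) (n : ℕ) → FiniteField.Carrier F → ℕ
countR F n u = length (filter (λ v → K cring (map enum v) ≟ u) (allVecs size n))
  where open FiniteField F

module Submission where

-- Expanding the tridiagonal determinant along its first row gives the continuant recurrence
-- K(a ∷ w) = a·K(w) − K(tail w).  Hence, for fixed w, the number of a with K(a ∷ w) = x is 1 if
-- K(w) ≠ 0, and is q or 0 (according as −K(tail w) = x) if K(w) = 0.  Summing over w, and using that
-- consecutive continuants never vanish together, the counts N(n, x) = |R_n^x| satisfy
--   N(n+1, 0) + N(n, 0) = qⁿ   and   N(n+2, x) + N(n+1, 0) = qⁿ⁺¹ + q·N(n, −x)   for x ≠ 0,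
-- and induction on m, first for N(2m+1, 0) and then for N(2m, x) with x ranging over the
-- negation-closed set of x ∉ {0, 1, −1}, gives the closed form.

open import Defs
open import Algebra.Bundles using (CommutativeRing)
open import Data.Bool.Base using (true; false; if_then_else_)
open import Data.Fin.Base using (Fin; zero; suc; toℕ; punchIn)
open import Data.Nat as ℕ using (ℕ; zero; suc; _≡ᵇ_)
open import Data.Vec.Base using (Vec; []; _∷_; lookup)
open import Function.Base using (_∘_)
open import Relation.Binary.PropositionalEquality as ≡ using (_≡_)
open import Relation.Nullary.Decidable using (Dec; does; yes; no; dec-true; dec-false)
open import Relation.Nullary.Negation using (¬_; contradiction)

module Continuant {c ℓ} (R : CommutativeRing c ℓ) where
  open CommutativeRing R hiding (zero)
  open import Algebra.Properties.Ring ring using (-0#≈0#; -‿injective; -‿involutive)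
  open import Relation.Binary.Reasoning.Setoid setoid

  -x≈0⇒x≈0 : ∀ {x} → - x ≈ 0# → x ≈ 0#
  -x≈0⇒x≈0 -x≈0 = -‿injective (trans -x≈0 (sym -0#≈0#))

  -x≈y⇒x≈-y : ∀ {x y} → - x ≈ y → x ≈ - y
  -x≈y⇒x≈-y {x} -x≈y = trans (sym (-‿involutive x)) (-‿cong -x≈y)

  sumFin-cong : ∀ {n} {f g : Fin n → Carrier} → (∀ j → f j ≈ g j) → sumFin R f ≈ sumFin R g
  sumFin-cong {zero}  f≈g = refl
  sumFin-cong {suc n} f≈g = +-cong (f≈g zero) (sumFin-cong (f≈g ∘ suc))

  sumFin-zero : ∀ {n} {f : Fin n → Carrier} → (∀ j → f j ≈ 0#) → sumFin R f ≈ 0#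
  sumFin-zero {zero}  f≈0 = refl
  sumFin-zero {suc n} f≈0 = trans (+-cong (f≈0 zero) (sumFin-zero (f≈0 ∘ suc))) (+-identityˡ 0#)

  signed-cong : ∀ k {x y} → x ≈ y → signed R k x ≈ signed R k y
  signed-cong zero    x≈y = x≈y
  signed-cong (suc k) x≈y = -‿cong (signed-cong k x≈y)

  signed-zero : ∀ k {x} → x ≈ 0# → signed R k x ≈ 0#
  signed-zero zero    x≈0 = x≈0
  signed-zero (suc k) x≈0 = trans (-‿cong (signed-zero k x≈0)) -0#≈0#

  det-cong : ∀ n {M N : Fin n → Fin n → Carrier} → (∀ i j → M i j ≈ N i j) → det R n M ≈ det R n N
  det-cong zero    M≈N = refl
  det-cong (suc n) M≈N = sumFin-cong λ j →
    signed-cong (toℕ j) (*-cong (M≈N zero j) (det-cong n λ i k → M≈N (suc i) (punchIn j k)))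

  det-firstColumn : ∀ n (M : Fin (suc n) → Fin (suc n) → Carrier) → (∀ i → M (suc i) zero ≈ 0#) →
    det R (suc n) M ≈ M zero zero * det R n (λ i k → M (suc i) (suc k))
  det-zeroColumn : ∀ n (M : Fin (suc n) → Fin (suc n) → Carrier) → (∀ i → M i zero ≈ 0#) →
    det R (suc n) M ≈ 0#

  det-firstColumn zero    M _      = +-identityʳ _
  det-firstColumn (suc n) M M·₀≈0 = trans (+-congˡ (sumFin-zero otherColumns≈0)) (+-identityʳ _)
    where
    minor : Fin (suc n) → Fin (suc n) → Fin (suc n) → Carrier
    minor j i k = M (suc i) (punchIn (suc j) k)
    otherColumns≈0 : ∀ j → signed R (suc (toℕ j)) (M zero (suc j) * det R (suc n) (minor j)) ≈ 0#
    otherColumns≈0 j = signed-zero (suc (toℕ j)) (trans (*-congˡ (det-zeroColumn n (minor j) M·₀≈0)) (zeroʳ _))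

  det-zeroColumn n M M·₀≈0 =
    trans (det-firstColumn n M (M·₀≈0 ∘ suc)) (trans (*-congʳ (M·₀≈0 zero)) (zeroˡ _))

  -- A with-free description of the entries of tridiag; unlike tridiag it computes on suc i and suc j.
  tridiagEntry : ℕ → ℕ → Carrier → Carrier
  tridiagEntry i j x = if i ≡ᵇ j then x else if suc i ≡ᵇ j then 1# else if i ≡ᵇ suc j then 1# else 0#

  tridiag-entry : ∀ {n} (X : Vec Carrier n) i j → tridiag R X i j ≈ tridiagEntry (toℕ i) (toℕ j) (lookup X i)
  tridiag-entry X i j with toℕ i ℕ.≟ toℕ j | suc (toℕ i) ℕ.≟ toℕ j | toℕ i ℕ.≟ suc (toℕ j)
  ... | yes i≡j | _ | _
    rewrite dec-true (toℕ i ℕ.≟ toℕ j) i≡j = refl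
  ... | no i≢j | yes 1+i≡j | _
    rewrite dec-false (toℕ i ℕ.≟ toℕ j) i≢j | dec-true (suc (toℕ i) ℕ.≟ toℕ j) 1+i≡j = refl
  ... | no i≢j | no 1+i≢j | yes i≡1+j
    rewrite dec-false (toℕ i ℕ.≟ toℕ j) i≢j | dec-false (suc (toℕ i) ℕ.≟ toℕ j) 1+i≢j
          | dec-true (toℕ i ℕ.≟ suc (toℕ j)) i≡1+j = refl
  ... | no i≢j | no 1+i≢j | no i≢1+j
    rewrite dec-false (toℕ i ℕ.≟ toℕ j) i≢j | dec-false (suc (toℕ i) ℕ.≟ toℕ j) 1+i≢j
          | dec-false (toℕ i ℕ.≟ suc (toℕ j)) i≢1+j = refl

  tridiag-suc : ∀ {n} a (X : Vec Carrier n) i j → tridiag R (a ∷ X) (suc i) (suc j) ≈ tridiag R X i j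
  tridiag-suc a X i j = trans (tridiag-entry (a ∷ X) (suc i) (suc j)) (sym (tridiag-entry X i j))

  K-tail : ∀ {n} → Vec Carrier n → Carrier
  K-tail []      = 0#
  K-tail (_ ∷ w) = K R w

  K-∷ : ∀ {n} a (w : Vec Carrier n) → K R (a ∷ w) ≈ a * K R w - K-tail w
  K-∷ a [] = +-cong (*-congʳ (tridiag-entry (a ∷ []) zero zero)) (sym -0#≈0#)
  K-∷ {suc n} a (b ∷ w) = begin
    K R (a ∷ b ∷ w)
      ≈⟨ +-cong (*-cong (tridiag-entry X zero zero) diagonalMinor)
                (+-cong (-‿cong (*-cong (tridiag-entry X zero (suc zero)) offDiagonalMinor)) otherColumns) ⟩
    a * K R (b ∷ w) + (- (1# * K R w) + 0#)
      ≈⟨ +-congˡ (trans (+-identityʳ _) (-‿cong (*-identityˡ _))) ⟩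
    a * K R (b ∷ w) - K R w
      ∎
    where
    X = a ∷ b ∷ w
    diagonalMinor : det R (suc n) (λ i k → tridiag R X (suc i) (suc k)) ≈ K R (b ∷ w)
    diagonalMinor = det-cong (suc n) (tridiag-suc a (b ∷ w))
    offDiagonalMinor : det R (suc n) (λ i k → tridiag R X (suc i) (punchIn (suc zero) k)) ≈ K R w
    offDiagonalMinor = begin
      det R (suc n) (λ i k → tridiag R X (suc i) (punchIn (suc zero) k))
        ≈⟨ det-firstColumn n (λ i k → tridiag R X (suc i) (punchIn (suc zero) k))
                             (λ i → tridiag-entry X (suc (suc i)) zero) ⟩
      tridiag R X (suc zero) zero * det R n (λ i k → tridiag R X (suc (suc i)) (suc (suc k)))
        ≈⟨ *-cong (tridiag-entry X (suc zero) zero)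
                  (det-cong n λ i k → trans (tridiag-suc a (b ∷ w) (suc i) (suc k)) (tridiag-suc b w i k)) ⟩
      1# * K R w
        ≈⟨ *-identityˡ _ ⟩
      K R w ∎
    otherColumns : sumFin R (λ j → signed R (toℕ (suc (suc j)))
             (tridiag R X zero (suc (suc j)) * det R (suc n) (λ i k → tridiag R X (suc i) (punchIn (suc (suc j)) k)))) ≈ 0#
    otherColumns = sumFin-zero λ j →
      signed-zero (toℕ (suc (suc j))) (trans (*-congʳ (tridiag-entry X zero (suc (suc j)))) (zeroˡ _))

  K≈0⇒K-tail≉0 : ¬ 0# ≈ 1# → ∀ {n} (w : Vec Carrier n) → K R w ≈ 0# → ¬ K-tail w ≈ 0#
  K≈0⇒K-tail≉0 0≉1 [] K≈0 _ = 0≉1 (sym K≈0)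
  K≈0⇒K-tail≉0 0≉1 (a ∷ w) K≈0 K-tail≈0 = K≈0⇒K-tail≉0 0≉1 w K-tail≈0 (-x≈0⇒x≈0 (begin
    - K-tail w               ≈⟨ +-identityˡ _ ⟨
    0# - K-tail w            ≈⟨ +-congʳ (trans (*-congˡ K-tail≈0) (zeroʳ a)) ⟨
    a * K R w - K-tail w     ≈⟨ K-∷ a w ⟨
    K R (a ∷ w)              ≈⟨ K≈0 ⟩
    0#                       ∎))

module FiniteSums where
  open import Data.Fin.Properties using (punchInᵢ≢i)
  open import Data.List.Base using (List; []; _∷_; _++_; map; filter; length; concatMap; tabulate; allFin)
  open import Data.List.Properties using (map-cong; map-++; map-∘)
  open import Data.Nat.Base using (_+_; _*_; _^_)
  open import Data.Nat.ListAction using (sum)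
  open import Data.Nat.ListAction.Properties using (sum-++)
  open import Data.Nat.Properties using (+-*-semiring; *-distribˡ-+; *-zeroʳ)
  open import Data.Nat.Tactic.RingSolver using (solve-∀)
  open import Function.Base using (id)
  open import Relation.Binary.PropositionalEquality using (refl; cong; cong₂; sym; trans)
  open import Algebra.Properties.Semiring.Sum +-*-semiring public using (sum-syntax; sum-cong-≗; *-distribʳ-sum)
    renaming (sum to ∑)
  open import Algebra.Properties.Semiring.Sum +-*-semiring using (sum-remove; sum-replicate-zero)

  χ : ∀ {a} {A : Set a} → Dec A → ℕ
  χ A? = if does A? then 1 else 0

  χ-yes : ∀ {a} {A : Set a} (A? : Dec A) → A → χ A? ≡ 1
  χ-yes A? a rewrite dec-true A? a = refl

  χ-no : ∀ {a} {A : Set a} (A? : Dec A) → ¬ A → χ A? ≡ 0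
  χ-no A? ¬a rewrite dec-false A? ¬a = refl

  module _ {a} {A : Set a} where

    length-filter : ∀ {p} {P : A → Set p} (P? : ∀ x → Dec (P x)) (xs : List A) →
      length (filter P? xs) ≡ sum (map (χ ∘ P?) xs)
    length-filter P? [] = refl
    length-filter P? (x ∷ xs) with does (P? x)
    ... | true  = cong suc (length-filter P? xs)
    ... | false = length-filter P? xs

    sum-map-cong : ∀ {f g : A → ℕ} (xs : List A) → (∀ x → f x ≡ g x) → sum (map f xs) ≡ sum (map g xs)
    sum-map-cong xs f≗g = cong sum (map-cong f≗g xs)

    sum-map-zero : ∀ {f : A → ℕ} (xs : List A) → (∀ x → f x ≡ 0) → sum (map f xs) ≡ 0
    sum-map-zero []       f≡0 = refl
    sum-map-zero (x ∷ xs) f≡0 = cong₂ _+_ (f≡0 x) (sum-map-zero xs f≡0)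

    sum-map-+ : ∀ (f g : A → ℕ) xs → sum (map (λ x → f x + g x) xs) ≡ sum (map f xs) + sum (map g xs)
    sum-map-+ f g [] = refl
    sum-map-+ f g (x ∷ xs) rewrite sum-map-+ f g xs = interchange (f x) (g x) (sum (map f xs)) (sum (map g xs))
      where
      interchange : ∀ a b c d → (a + b) + (c + d) ≡ (a + c) + (b + d)
      interchange = solve-∀

    sum-map-*ˡ : ∀ k (f : A → ℕ) xs → sum (map (λ x → k * f x) xs) ≡ k * sum (map f xs)
    sum-map-*ˡ k f []       = sym (*-zeroʳ k)
    sum-map-*ˡ k f (x ∷ xs) = trans (cong (k * f x +_) (sum-map-*ˡ k f xs)) (sym (*-distribˡ-+ k (f x) _))

    sum-map-concatMap : ∀ {b} {B : Set b} (g : A → List B) (f : B → ℕ) xs →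
      sum (map f (concatMap g xs)) ≡ sum (map (λ x → sum (map f (g x))) xs)
    sum-map-concatMap g f []       = refl
    sum-map-concatMap g f (x ∷ xs) = begin
      sum (map f (g x ++ concatMap g xs))                         ≡⟨ cong sum (map-++ f (g x) _) ⟩
      sum (map f (g x) ++ map f (concatMap g xs))                 ≡⟨ sum-++ (map f (g x)) _ ⟩
      sum (map f (g x)) + sum (map f (concatMap g xs))            ≡⟨ cong (sum (map f (g x)) +_) (sum-map-concatMap g f xs) ⟩
      sum (map f (g x)) + sum (map (λ x → sum (map f (g x))) xs)  ∎
      where open ≡.≡-Reasoning

    sum-map-tabulate : ∀ {n} (g : Fin n → A) (f : A → ℕ) → sum (map f (tabulate g)) ≡ ∑[ i < n ] f (g i)
    sum-map-tabulate {zero}  g f = refl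
    sum-map-tabulate {suc n} g f = cong (f (g zero) +_) (sum-map-tabulate (g ∘ suc) f)

  ∑-const : ∀ n k → ∑[ i < n ] k ≡ n * k
  ∑-const zero    k = refl
  ∑-const (suc n) k = cong (k +_) (∑-const n k)

  ∑-χ-unique : ∀ {n p} {P : Fin n → Set p} (P? : ∀ i → Dec (P i)) i → P i → (∀ j → P j → j ≡ i) →
    ∑[ j < n ] χ (P? j) ≡ 1
  ∑-χ-unique {suc n} P? i Pi unique = begin
    ∑[ j < suc n ] χ (P? j)                        ≡⟨ sum-remove {i = i} (χ ∘ P?) ⟩
    χ (P? i) + ∑[ j < n ] χ (P? (punchIn i j))     ≡⟨ cong₂ _+_ (χ-yes (P? i) Pi) (sum-cong-≗ others) ⟩
    1 + ∑[ j < n ] 0                               ≡⟨ cong suc (sum-replicate-zero n) ⟩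
    1                                              ∎
    where
    open ≡.≡-Reasoning
    others : ∀ j → χ (P? (punchIn i j)) ≡ 0
    others j = χ-no (P? (punchIn i j)) (punchInᵢ≢i i j ∘ unique (punchIn i j))

  allVecs-suc : ∀ q n (f : Vec (Fin q) (suc n) → ℕ) →
    sum (map f (allVecs q (suc n))) ≡ sum (map (λ w → ∑[ a < q ] f (a ∷ w)) (allVecs q n))
  allVecs-suc q n f = trans (sum-map-concatMap _ f (allVecs q n)) (sum-map-cong (allVecs q n) λ w →
    trans (cong sum (sym (map-∘ (allFin q)))) (sum-map-tabulate id (f ∘ (_∷ w))))

  allVecs-count : ∀ q n → sum (map (λ _ → 1) (allVecs q n)) ≡ q ^ n
  allVecs-count q zero    = refl
  allVecs-count q (suc n) = begin
    sum (map (λ _ → 1) (allVecs q (suc n)))               ≡⟨ allVecs-suc q n (λ _ → 1) ⟩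
    sum (map (λ _ → ∑[ a < q ] 1) (allVecs q n))          ≡⟨ sum-map-cong (allVecs q n) (λ _ → ∑-const q 1) ⟩
    sum (map (λ _ → q * 1) (allVecs q n))                 ≡⟨ sum-map-*ˡ q (λ _ → 1) (allVecs q n) ⟩
    q * sum (map (λ _ → 1) (allVecs q n))                 ≡⟨ cong (q *_) (allVecs-count q n) ⟩
    q ^ suc n                                             ∎
    where open ≡.≡-Reasoning

module NatArithmetic where
  open import Data.Nat.Base
  open import Data.Nat.Properties
  open import Data.Nat.Tactic.RingSolver using (solve-∀)
  open import Relation.Binary.PropositionalEquality
  open ≡-Reasoning

  ^-suc-double : ∀ q m → q ^ suc (2 * m) ≡ q ^ suc m * q ^ m
  ^-suc-double q m = begin
    q ^ suc (m + (m + 0)) ≡⟨ cong (λ k → q ^ suc (m + k)) (+-identityʳ m) ⟩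
    q * q ^ (m + m)       ≡⟨ cong (q *_) (^-distribˡ-+-* q m m) ⟩
    q * (q ^ m * q ^ m)   ≡⟨ *-assoc q _ _ ⟨
    q ^ suc m * q ^ m     ∎

  odd-step : ∀ q Q x y z → y + x ≡ Q → z + y ≡ q * Q →
    (q + 1) * x ≡ Q + 1 → (q + 1) * z ≡ q * (q * Q) + 1
  odd-step q Q x y z y+x≡Q z+y≡qQ [q+1]x≡Q+1 = +-cancelʳ-≡ ((q + 1) * Q) _ _ (begin
    (q + 1) * z + (q + 1) * Q           ≡⟨ cong (λ t → (q + 1) * z + (q + 1) * t) y+x≡Q ⟨
    (q + 1) * z + (q + 1) * (y + x)     ≡⟨ regroup q x y z ⟩
    (q + 1) * (z + y) + (q + 1) * x     ≡⟨ cong₂ (λ s t → (q + 1) * s + t) z+y≡qQ [q+1]x≡Q+1 ⟩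
    (q + 1) * (q * Q) + (Q + 1)         ≡⟨ expand q Q ⟩
    q * (q * Q) + 1 + (q + 1) * Q       ∎)
    where
    regroup : ∀ q x y z → (q + 1) * z + (q + 1) * (y + x) ≡ (q + 1) * (z + y) + (q + 1) * x
    regroup = solve-∀
    expand : ∀ q Q → (q + 1) * (q * Q) + (Q + 1) ≡ q * (q * Q) + 1 + (q + 1) * Q
    expand = solve-∀

  -- q = suc p and q ^ 2 = q * (q * 1) are spelled out because the solver handles neither let nor _^_.
  even-step-identity : ∀ p B T T′ z →
    T * (suc p * (suc p * 1)) + suc p * (suc p * B) + suc p * B
      + (p * (p + 2) * (suc p * B * B + suc p * T′) + p * ((suc p + 1) * z) + suc p * (T′ + suc p * B * B + 1))
    ≡ T + suc p * (suc p * B) * (suc p * B) + 1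
      + (p * (p + 2) * (T + z) + p * (suc p * B * B + 1) + suc p * (T′ * (suc p * (suc p * 1)) + suc p * B + B))
  even-step-identity = solve-∀

  -- The conclusion is (q² − 1)·h₁ − (q − 1)·h₂ + q·h₃, rearranged so that no subtraction occurs.
  even-step : ∀ {q} → 1 ≤ q → ∀ B T T′ z →
    T + z ≡ q * B * B + q * T′ → (q + 1) * z ≡ q * B * B + 1 →
    T′ * q ^ 2 + q * B + B ≡ T′ + q * B * B + 1 →
    T * q ^ 2 + q * (q * B) + q * B ≡ T + q * (q * B) * (q * B) + 1
  even-step {suc p} (s≤s z≤n) B T T′ z h₁ h₂ h₃ = +-cancelʳ-≡ S _ _ (begin
    T * q ^ 2 + q * (q * B) + q * B + S
      ≡⟨ even-step-identity p B T T′ z ⟩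
    T + q * (q * B) * (q * B) + 1 + (p * (p + 2) * (T + z) + p * (q * B * B + 1) + q * (T′ * q ^ 2 + q * B + B))
      ≡⟨ cong (T + q * (q * B) * (q * B) + 1 +_)
              (cong₂ _+_ (cong₂ (λ s t → p * (p + 2) * s + p * t) h₁ (sym h₂)) (cong (q *_) h₃)) ⟩
    T + q * (q * B) * (q * B) + 1 + S ∎)
    where
    q = suc p
    S = p * (p + 2) * (q * B * B + q * T′) + p * ((q + 1) * z) + q * (T′ + q * B * B + 1)

  additive⇒monus : ∀ T s a b → 1 ≤ s → 1 ≤ a → 1 ≤ b →
    T * s + a + b ≡ T + a * b + 1 → T * (s ∸ 1) ≡ (a ∸ 1) * (b ∸ 1)
  additive⇒monus T (suc s) (suc a) (suc b) _ _ _ h = +-cancelʳ-≡ (T + a + b + 2) _ _ (begin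
    T * s + (T + a + b + 2)      ≡⟨ expandˡ T s a b ⟩
    T * suc s + suc a + suc b    ≡⟨ h ⟩
    T + suc a * suc b + 1        ≡⟨ expandʳ T a b ⟩
    a * b + (T + a + b + 2)      ∎)
    where
    expandˡ : ∀ T s a b → T * s + (T + a + b + 2) ≡ T * suc s + suc a + suc b
    expandˡ = solve-∀
    expandʳ : ∀ T a b → T + suc a * suc b + 1 ≡ a * b + (T + a + b + 2)
    expandʳ = solve-∀

module LinearEquations {c ℓ} (F : FiniteField c ℓ) where
  open FiniteField F using (cring; size; enum; enum-inj; enum-sur; inverse; 0≉1) renaming (_≟_ to infix 4 _≟_)
  open CommutativeRing cring hiding (zero)
  open import Algebra.Properties.Ring ring using (//-rightDividesˡ; //-rightDividesʳ)
  import Data.Nat.Properties as ℕₚ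
  open import Data.Product using (_,_)
  open import Relation.Binary.Reasoning.Setoid setoid
  open FiniteSums

  χ-≈ : ∀ {x y} z → x ≈ y → χ (x ≟ z) ≡ χ (y ≟ z)
  χ-≈ {x} {y} z x≈y with x ≟ z | y ≟ z
  ... | yes _   | yes _   = ≡.refl
  ... | no _    | no _    = ≡.refl
  ... | yes x≈z | no y≉z  = contradiction (trans (sym x≈y) x≈z) y≉z
  ... | no x≉z  | yes y≈z = contradiction (trans x≈y y≈z) x≉z

  unit⇒≉0 : ∀ {u} → IsUnit cring u → ¬ u ≈ 0#
  unit⇒≉0 (v , uv≈1) u≈0 = 0≉1 (trans (sym (zeroˡ v)) (trans (*-congʳ (sym u≈0)) uv≈1))

  solutions : Carrier → Carrier → Carrier → ℕ
  solutions c d x = ∑[ a < size ] χ (enum a * c - d ≟ x)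

  solutions-unique : ∀ {c} d x → ¬ c ≈ 0# → solutions c d x ≡ 1
  solutions-unique {c} d x c≉0 with inverse c c≉0
  ... | c⁻¹ , cc⁻¹≈1 with enum-sur ((x + d) * c⁻¹)
  ... | i , enum-i≈root = ∑-χ-unique (λ a → enum a * c - d ≟ x) i solves unique
    where
    root : ∀ a → a * c - d ≈ x → a ≈ (x + d) * c⁻¹
    root a ac-d≈x = begin
      a                      ≈⟨ *-identityʳ a ⟨
      a * 1#                 ≈⟨ *-congˡ cc⁻¹≈1 ⟨
      a * (c * c⁻¹)          ≈⟨ *-assoc a c c⁻¹ ⟨
      a * c * c⁻¹            ≈⟨ *-congʳ (//-rightDividesˡ d (a * c)) ⟨
      (a * c - d + d) * c⁻¹  ≈⟨ *-congʳ (+-congʳ ac-d≈x) ⟩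
      (x + d) * c⁻¹          ∎
    solves : enum i * c - d ≈ x
    solves = begin
      enum i * c - d           ≈⟨ +-congʳ (*-congʳ enum-i≈root) ⟩
      (x + d) * c⁻¹ * c - d    ≈⟨ +-congʳ (trans (*-assoc _ c⁻¹ c) (*-congˡ (*-comm c⁻¹ c))) ⟩
      (x + d) * (c * c⁻¹) - d  ≈⟨ +-congʳ (trans (*-congˡ cc⁻¹≈1) (*-identityʳ _)) ⟩
      (x + d) - d              ≈⟨ //-rightDividesʳ d x ⟩
      x                        ∎
    unique : ∀ j → enum j * c - d ≈ x → j ≡ i
    unique j solves-j = enum-inj j i (trans (root (enum j) solves-j) (sym enum-i≈root))

  solutions-degenerate : ∀ {c} d x → c ≈ 0# → solutions c d x ≡ size ℕ.* χ (- d ≟ x)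
  solutions-degenerate {c} d x c≈0 =
    ≡.trans (sum-cong-≗ (λ a → χ-≈ x (constant (enum a)))) (∑-const size (χ (- d ≟ x)))
    where
    constant : ∀ a → a * c - d ≈ - d
    constant a = trans (+-congʳ (trans (*-congˡ c≈0) (zeroʳ a))) (+-identityˡ (- d))

  solutions+χ : ∀ c d x →
    solutions c d x ℕ.+ χ (c ≟ 0#) ≡ 1 ℕ.+ size ℕ.* (χ (c ≟ 0#) ℕ.* χ (- d ≟ x))
  solutions+χ c d x with c ≟ 0#
  ... | yes c≈0 = ≡.trans (ℕₚ.+-comm (solutions c d x) 1)
      (≡.cong suc (≡.trans (solutions-degenerate d x c≈0) (≡.cong (size ℕ.*_) (≡.sym (ℕₚ.*-identityˡ _)))))
  ... | no c≉0  = ≡.trans (ℕₚ.+-identityʳ _) (≡.trans (solutions-unique d x c≉0) (≡.cong suc (≡.sym (ℕₚ.*-zeroʳ size))))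

module Counting {c ℓ} (F : FiniteField c ℓ) where
  open FiniteField F using (cring; size; enum; enum-sur; 0≉1) renaming (_≟_ to infix 4 _≟_)
  open CommutativeRing cring using (Carrier; _≈_; -_; 0#; 1#; sym; trans; -‿cong; ring)
  open import Algebra.Properties.Ring ring using (-0#≈0#; -‿involutive)
  open import Data.Fin.Properties using (nonZeroIndex)
  open import Data.List.Base using (map)
  open import Data.Nat.Base using (_+_; _*_; _^_; NonZero; >-nonZero⁻¹)
  open import Data.Nat.ListAction using (sum)
  open import Data.Nat.Properties using (+-identityʳ; *-identityʳ; *-zeroʳ; *-suc; *-distribʳ-+)
  open import Data.Product using (_×_; _,_; proj₁)
  import Data.Vec.Base as Vec
  open Continuant cring
  open FiniteSums
  open LinearEquations F
  open NatArithmetic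
  open ≡.≡-Reasoning

  ⟦_⟧ : ∀ {n} → Vec (Fin size) n → Vec Carrier n
  ⟦_⟧ = Vec.map enum

  N : ℕ → Carrier → ℕ
  N = countR F

  N-sum : ∀ n x → N n x ≡ sum (map (λ w → χ (K cring ⟦ w ⟧ ≟ x)) (allVecs size n))
  N-sum n x = length-filter (λ w → K cring ⟦ w ⟧ ≟ x) (allVecs size n)

  N-suc-sum : ∀ n x → N (suc n) x ≡ sum (map (λ w → solutions (K cring ⟦ w ⟧) (K-tail ⟦ w ⟧) x) (allVecs size n))
  N-suc-sum n x = ≡.trans (N-sum (suc n) x) (≡.trans (allVecs-suc size n _)
    (sum-map-cong (allVecs size n) λ w → sum-cong-≗ λ a → χ-≈ x (K-∷ (enum a) ⟦ w ⟧)))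

  vanishingWithTail : ℕ → Carrier → ℕ
  vanishingWithTail n x = sum (map (λ w → χ (K cring ⟦ w ⟧ ≟ 0#) * χ (- K-tail ⟦ w ⟧ ≟ x)) (allVecs size n))

  N-suc+N₀ : ∀ n x → N (suc n) x + N n 0# ≡ size ^ n + size * vanishingWithTail n x
  N-suc+N₀ n x = begin
    N (suc n) x + N n 0#
      ≡⟨ ≡.cong₂ _+_ (N-suc-sum n x) (N-sum n 0#) ⟩
    sum (map solutionsAt vs) + sum (map vanishes vs)
      ≡⟨ sum-map-+ solutionsAt vanishes vs ⟨
    sum (map (λ w → solutionsAt w + vanishes w) vs)
      ≡⟨ sum-map-cong vs (λ w → solutions+χ (K cring ⟦ w ⟧) (K-tail ⟦ w ⟧) x) ⟩
    sum (map (λ w → 1 + size * (vanishes w * tailIs w)) vs)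
      ≡⟨ sum-map-+ (λ _ → 1) _ vs ⟩
    sum (map (λ _ → 1) vs) + sum (map (λ w → size * (vanishes w * tailIs w)) vs)
      ≡⟨ ≡.cong₂ _+_ (allVecs-count size n) (sum-map-*ˡ size _ vs) ⟩
    size ^ n + size * vanishingWithTail n x
      ∎
    where
    vs = allVecs size n
    solutionsAt vanishes tailIs : Vec (Fin size) n → ℕ
    solutionsAt w = solutions (K cring ⟦ w ⟧) (K-tail ⟦ w ⟧) x
    vanishes w = χ (K cring ⟦ w ⟧ ≟ 0#)
    tailIs w = χ (- K-tail ⟦ w ⟧ ≟ x)

  vanishingWithTail-zero : ∀ n → vanishingWithTail n 0# ≡ 0
  vanishingWithTail-zero n = sum-map-zero (allVecs size n) term
    where
    term : ∀ w → χ (K cring ⟦ w ⟧ ≟ 0#) * χ (- K-tail ⟦ w ⟧ ≟ 0#) ≡ 0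
    term w with K cring ⟦ w ⟧ ≟ 0#
    ... | no _    = ≡.refl
    ... | yes K≈0 = ≡.cong (1 *_) (χ-no (- K-tail ⟦ w ⟧ ≟ 0#) (K≈0⇒K-tail≉0 0≉1 ⟦ w ⟧ K≈0 ∘ -x≈0⇒x≈0))

  vanishingWithTail-suc : ∀ n {x} → ¬ x ≈ 0# → vanishingWithTail (suc n) x ≡ N n (- x)
  vanishingWithTail-suc n {x} x≉0 = ≡.trans (allVecs-suc size n _)
    (≡.trans (sum-map-cong (allVecs size n) term) (≡.sym (N-sum n (- x))))
    where
    extensionsToZero : ∀ k d → solutions k d 0# * χ (- k ≟ x) ≡ χ (k ≟ - x)
    extensionsToZero k d with - k ≟ x
    ... | yes -k≈x = ≡.trans (*-identityʳ _) (≡.trans (solutions-unique d 0# k≉0)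
                       (≡.sym (χ-yes (k ≟ - x) (-x≈y⇒x≈-y -k≈x))))
      where
      k≉0 : ¬ k ≈ 0#
      k≉0 k≈0 = x≉0 (trans (sym -k≈x) (trans (-‿cong k≈0) -0#≈0#))
    ... | no -k≉x = ≡.trans (*-zeroʳ (solutions k d 0#))
                      (≡.sym (χ-no (k ≟ - x) λ k≈-x → -k≉x (trans (-‿cong k≈-x) (-‿involutive x))))
    term : ∀ w → ∑[ a < size ] (χ (K cring (enum a ∷ ⟦ w ⟧) ≟ 0#) * χ (- K cring ⟦ w ⟧ ≟ x)) ≡ χ (K cring ⟦ w ⟧ ≟ - x)
    term w = begin
      ∑[ a < size ] (χ (K cring (enum a ∷ ⟦ w ⟧) ≟ 0#) * χ (- K cring ⟦ w ⟧ ≟ x))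
        ≡⟨ *-distribʳ-sum (χ (- K cring ⟦ w ⟧ ≟ x)) (λ a → χ (K cring (enum a ∷ ⟦ w ⟧) ≟ 0#)) ⟨
      ∑[ a < size ] χ (K cring (enum a ∷ ⟦ w ⟧) ≟ 0#) * χ (- K cring ⟦ w ⟧ ≟ x)
        ≡⟨ ≡.cong (_* χ (- K cring ⟦ w ⟧ ≟ x)) (sum-cong-≗ λ a → χ-≈ 0# (K-∷ (enum a) ⟦ w ⟧)) ⟩
      solutions (K cring ⟦ w ⟧) (K-tail ⟦ w ⟧) 0# * χ (- K cring ⟦ w ⟧ ≟ x)
        ≡⟨ extensionsToZero (K cring ⟦ w ⟧) (K-tail ⟦ w ⟧) ⟩
      χ (K cring ⟦ w ⟧ ≟ - x)
        ∎

  N₀-recurrence : ∀ n → N (suc n) 0# + N n 0# ≡ size ^ n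
  N₀-recurrence n = begin
    N (suc n) 0# + N n 0#                     ≡⟨ N-suc+N₀ n 0# ⟩
    size ^ n + size * vanishingWithTail n 0#  ≡⟨ ≡.cong (λ t → size ^ n + size * t) (vanishingWithTail-zero n) ⟩
    size ^ n + size * 0                       ≡⟨ ≡.cong (size ^ n +_) (*-zeroʳ size) ⟩
    size ^ n + 0                              ≡⟨ +-identityʳ _ ⟩
    size ^ n                                  ∎

  N-recurrence : ∀ n {x} → ¬ x ≈ 0# → N (suc (suc n)) x + N (suc n) 0# ≡ size ^ suc n + size * N n (- x)
  N-recurrence n x≉0 =
    ≡.trans (N-suc+N₀ (suc n) _) (≡.cong (λ t → size ^ suc n + size * t) (vanishingWithTail-suc n x≉0))

  N-empty : ∀ {x} → ¬ 1# ≈ x → N 0 x ≡ 0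
  N-empty {x} 1≉x = ≡.trans (N-sum 0 x) (≡.cong (_+ 0) (χ-no (1# ≟ x) 1≉x))

  instance
    size-nonZero : NonZero size
    size-nonZero = nonZeroIndex (proj₁ (enum-sur 0#))

  N₀-odd : ∀ m → (size + 1) * N (suc (2 * m)) 0# ≡ size ^ suc (2 * m) + 1
  N₀-odd zero = ≡.trans (≡.cong ((size + 1) *_) N₀-one) (*-distribʳ-+ 1 size 1)
    where
    N₀-one : N 1 0# ≡ 1
    N₀-one = begin
      N 1 0#           ≡⟨ +-identityʳ _ ⟨
      N 1 0# + 0       ≡⟨ ≡.cong (N 1 0# +_) (N-empty (0≉1 ∘ sym)) ⟨
      N 1 0# + N 0 0#  ≡⟨ N₀-recurrence 0 ⟩
      1                ∎
  N₀-odd (suc m) = ≡.subst (λ k → (size + 1) * N (suc k) 0# ≡ size ^ suc k + 1) (≡.sym (*-suc 2 m))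
    (odd-step size (size ^ suc (2 * m)) _ _ _
      (N₀-recurrence (suc (2 * m))) (N₀-recurrence (suc (suc (2 * m)))) (N₀-odd m))

  Avoids0±1 : Carrier → Set ℓ
  Avoids0±1 x = ¬ x ≈ 0# × ¬ x ≈ 1# × ¬ x ≈ - 1#

  avoids0±1-neg : ∀ {x} → Avoids0±1 x → Avoids0±1 (- x)
  avoids0±1-neg (x≉0 , x≉1 , x≉-1) =
    x≉0 ∘ -x≈0⇒x≈0 , x≉-1 ∘ -x≈y⇒x≈-y , λ -x≈-1 → x≉1 (trans (-x≈y⇒x≈-y -x≈-1) (-‿involutive 1#))

  -- N(2m, x)·(q² − 1) = (q^(m+1) − 1)(q^m − 1) with the subtractions moved across.
  N-even : ∀ m {x} → Avoids0±1 x →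
    N (2 * m) x * size ^ 2 + size ^ suc m + size ^ m ≡ N (2 * m) x + size ^ suc m * size ^ m + 1
  N-even zero (_ , x≉1 , _) rewrite N-empty (x≉1 ∘ sym) = ≡.cong (_+ 1) (≡.sym (*-identityʳ (size * 1)))
  N-even (suc m) {x} avoids@(x≉0 , _) = ≡.subst
    (λ k → N k x * size ^ 2 + size ^ suc (suc m) + size ^ suc m ≡ N k x + size ^ suc (suc m) * size ^ suc m + 1)
    (≡.sym (*-suc 2 m))
    (even-step (>-nonZero⁻¹ size) (size ^ m) _ _ _
      (≡.trans (N-recurrence (2 * m) x≉0) (≡.cong (_+ size * N (2 * m) (- x)) (^-suc-double size m)))
      (≡.trans (N₀-odd m) (≡.cong (_+ 1) (^-suc-double size m)))
      (N-even m (avoids0±1-neg avoids)))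

open import Data.Nat using (_*_; _∸_; _^_; _≤_)
open import Data.Nat.Properties using (m^n>0)
open import Data.Product using (_,_)

lemma3p7 : ∀ {c ℓ} (F : FiniteField c ℓ) (q : ℕ) → IsPrimePower q → FiniteField.size F ≡ q →
    (u : FiniteField.Carrier F) → IsUnit (FiniteField.cring F) u →
    ¬ (FiniteField._≈_ F u (FiniteField.1# F)) →
    ¬ (FiniteField._≈_ F u (FiniteField.-_ F (FiniteField.1# F))) →
    (m : ℕ) → 2 ≤ m →
    countR F (2 * m) u * (q ^ 2 ∸ 1) ≡ (q ^ suc m ∸ 1) * (q ^ m ∸ 1)
lemma3p7 F q _ ≡.refl u unit u≉1 u≉-1 m _ =
  NatArithmetic.additive⇒monus _ _ _ _ (m^n>0 q 2) (m^n>0 q (suc m)) (m^n>0 q m)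
    (N-even m (unit⇒≉0 unit , u≉1 , u≉-1))
  where
  open Counting F
  open LinearEquations F using (unit⇒≉0)
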